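{- Let $p\ge 5$ be a prime. The following statements are equivalent: (i) $p$ is a Wolstenholme prime; (ii) for all nonnegative integers $n$ and $m$, $\binom{np}{mp}\equiv \binom{n}{m}\pmod{p^4}$; (iii) for all nonnegative integers $n,m,n_0,m_0$ with $n_0<p$ and $m_0<p$, $$\binom{np^4+n_0}{mp^4+m_0}\equiv \binom{n}{m}\binom{n_0}{m_0}\pmod{p^4}.$$
   Context: A prime $p$ is called a Wolstenholme prime if $\binom{2p-1}{p-1}\equiv 1\pmod{p^4}$, equivalently $\binom{2p}{p}\equiv 2\pmod{p^4}$. Binomial coefficients follow the conventions $\binom{0}{0}=1$ and $\binom{l}{r}=0$ whenever $l<r$ (for nonnegative integers $l,r$). -}

module Defs where

open import Data.Nat using (ℕ; _+_; _*_; _^_; _<_; ∣_-_∣)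
open import Data.Nat.Divisibility using (_∣_)
open import Data.Nat.Combinatorics using (_C_)
open import Relation.Binary.PropositionalEquality using (_≡_)

infix 4 _≡_[mod_]
_≡_[mod_] : ℕ → ℕ → ℕ → Set
a ≡ b [mod m ] = m ∣ ∣ a - b ∣

-- Wolstenholme prime (as in the paper): binom(2p-1, p-1) ≡ 1 (mod p^4).
-- Written with (p + p) ∸ 1 and p ∸ 1 (p ≥ 5 in the theorem, so no truncation issue).
open import Data.Nat using (_∸_)
IsWolstenholme : ℕ → Set
IsWolstenholme p = ((p + p) ∸ 1) C (p ∸ 1) ≡ 1 [mod p ^ 4 ]

module Submission where

-- Write p = q + 1 and block t = (tp + 1) ⋯ (tp + q), so that (kp)! = blocks k · p^k · k! with
-- blocks k = block 0 ⋯ block (k - 1).  Hence C(np, mp) ≡ C(n, m) (mod p⁴) as soon as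
-- blocks k ≡ (q!)^k (mod p⁴) for k = m, n - m and n.  Pairing r with p - r gives
-- block t² ≡ (q!)² + t(t + 1)·W (mod p⁴) with W = p²·e_{q-1}(r(p - r) : 1 ≤ r ≤ q), and expanding
-- to first order in W gives blocks k² ≡ (q!)^{2k} + W·B_k, where p ∣ B_k whenever p ∣ k.  As
-- blocks k ≡ (q!)^k (mod p), congruences between the squares lift to the blocks themselves.
--
-- (i) says block 1 ≡ q!, i.e. p⁴ ∣ W, so all blocks behave and (ii) follows; conversely (ii) for
-- C(2p, p) = 2·C(2p - 1, p - 1) gives (i).  A Lucas-type induction shows
-- C(N + n₀, M + m₀) ≡ C(N, M)·C(n₀, m₀) (mod p⁴) when p⁴ ∣ N and p ∣ M, so (ii), applied four
-- times to C(np⁴, mp⁴), gives (iii).  Finally Wolstenholme's theorem ∑ 1/r² ≡ 0 (mod p) (the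
-- substitution r ↦ 2r multiplies the sum by 1/4) gives p³ ∣ W; then C(2Mp, Mp) ≡ C(2M, M)
-- whenever p ∣ M, and (iii) for C(2p⁴, p⁴) descends to C(2p, p) ≡ 2.

open import Data.Empty using (⊥-elim)
open import Data.Integer as ℤ using () renaming (+_ to ⁺_)
import Data.Integer.Properties as ℤ
import Data.Integer.Divisibility.Signed as ℤ
import Data.Integer.Tactic.RingSolver as ℤ-Solver
open import Data.Nat
open import Data.Nat.Combinatorics
open import Data.Nat.Coprimality using (Coprime; coprime?; coprime-Bézout)
open import Data.Nat.Divisibility
open import Data.Nat.DivMod using (_%_; _/_; m≡m%n+[m/n]*n; [m+n]%n≡m%n; m<n⇒m%n≡m; m/n*n≡m)
open import Data.Nat.GCD using (module Bézout)
open import Data.Nat.Primality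
open import Data.Nat.Properties
open import Data.Nat.Tactic.RingSolver using (solve-∀; solve)
open import Data.List using (_∷_; [])
open import Data.Product using (∃-syntax; _×_; _,_)
open import Data.Sum using (_⊎_; inj₁; inj₂)
open import Function.Base using (_∘_)
open import Function.Bundles using (_⇔_; mk⇔)
open import Level using (0ℓ)
open import Relation.Binary.Bundles using (Setoid)
open import Relation.Binary.PropositionalEquality
open import Relation.Nullary using (¬_; yes; no)
import Relation.Binary.Reasoning.Setoid as SetoidReasoning

open import Defs

∣⁺m-⁺n∣≡∣m-n∣ : ∀ m n → ℤ.∣ ⁺ m ℤ.- ⁺ n ∣ ≡ ∣ m - n ∣
∣⁺m-⁺n∣≡∣m-n∣ m n rewrite ℤ.m-n≡m⊖n m n with ≤-total m n
... | inj₁ m≤n = trans (ℤ.∣⊖∣-≤ m≤n) (sym (m≤n⇒∣m-n∣≡n∸m m≤n))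
... | inj₂ n≤m = trans (ℤ.∣m⊖n∣≡∣n⊖m∣ m n) (trans (ℤ.∣⊖∣-≤ n≤m) (sym (m≤n⇒∣n-m∣≡n∸m n≤m)))

-- A record around _≡_[mod_], so that Agda can infer the two sides from the type of a proof.
infix 4 _≈_[mod_]
record _≈_[mod_] (a b m : ℕ) : Set where
  constructor mod
  field unmod : a ≡ b [mod m ]

open _≈_[mod_]

module _ {m : ℕ} where

  mod⇒∣ℤ : ∀ {a b} → a ≈ b [mod m ] → ⁺ m ℤ.∣ (⁺ a ℤ.- ⁺ b)
  mod⇒∣ℤ {a} {b} (mod h) = ℤ.∣ᵤ⇒∣ (subst (m ∣_) (sym (∣⁺m-⁺n∣≡∣m-n∣ a b)) h)

  ∣ℤ⇒mod : ∀ {a b} → ⁺ m ℤ.∣ (⁺ a ℤ.- ⁺ b) → a ≈ b [mod m ]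
  ∣ℤ⇒mod {a} {b} h = mod (subst (m ∣_) (∣⁺m-⁺n∣≡∣m-n∣ a b) (ℤ.∣⇒∣ᵤ h))

  mod-reflexive : ∀ {a b} → a ≡ b → a ≈ b [mod m ]
  mod-reflexive {a} refl = mod (subst (m ∣_) (sym (m≡n⇒∣m-n∣≡0 {a} refl)) (m ∣0))

  mod-refl : ∀ {a} → a ≈ a [mod m ]
  mod-refl = mod-reflexive refl

  mod-sym : ∀ {a b} → a ≈ b [mod m ] → b ≈ a [mod m ]
  mod-sym {a} {b} (mod h) = mod (subst (m ∣_) (∣-∣-comm a b) h)

  mod-trans : ∀ {a b c} → a ≈ b [mod m ] → b ≈ c [mod m ] → a ≈ c [mod m ]
  mod-trans {a} {b} {c} h k = ∣ℤ⇒mod (subst (⁺ m ℤ.∣_) (telescope (⁺ a) (⁺ b) (⁺ c))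
    (ℤ.∣m∣n⇒∣m+n (mod⇒∣ℤ h) (mod⇒∣ℤ k)))
    where
    telescope : ∀ x y z → (x ℤ.- y) ℤ.+ (y ℤ.- z) ≡ x ℤ.- z
    telescope = ℤ-Solver.solve-∀

modSetoid : ℕ → Setoid 0ℓ 0ℓ
modSetoid m = record
  { Carrier = ℕ
  ; _≈_ = _≈_[mod m ]
  ; isEquivalence = record { refl = mod-refl ; sym = mod-sym ; trans = mod-trans }
  }

module ≈-mod-Reasoning (m : ℕ) = SetoidReasoning (modSetoid m)

module _ {m : ℕ} where

  +-cong-mod : ∀ {a b c d} → a ≈ b [mod m ] → c ≈ d [mod m ] → a + c ≈ b + d [mod m ]
  +-cong-mod {a} {b} {c} {d} h k = ∣ℤ⇒mod (subst (⁺ m ℤ.∣_) (regroup (⁺ a) (⁺ b) (⁺ c) (⁺ d))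
    (ℤ.∣m∣n⇒∣m+n (mod⇒∣ℤ h) (mod⇒∣ℤ k)))
    where
    regroup : ∀ x y z w → (x ℤ.- y) ℤ.+ (z ℤ.- w) ≡ (x ℤ.+ z) ℤ.- (y ℤ.+ w)
    regroup = ℤ-Solver.solve-∀

  *-cong-mod : ∀ {a b c d} → a ≈ b [mod m ] → c ≈ d [mod m ] → a * c ≈ b * d [mod m ]
  *-cong-mod {a} {b} {c} {d} h k = ∣ℤ⇒mod (subst (⁺ m ℤ.∣_) products
    (ℤ.∣m∣n⇒∣m+n (ℤ.∣m⇒∣m*n (⁺ c) (mod⇒∣ℤ h)) (ℤ.∣n⇒∣m*n (⁺ b) (mod⇒∣ℤ k))))
    where
    expand : ∀ x y z w → (x ℤ.- y) ℤ.* z ℤ.+ y ℤ.* (z ℤ.- w) ≡ x ℤ.* z ℤ.- y ℤ.* w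
    expand = ℤ-Solver.solve-∀
    products : (⁺ a ℤ.- ⁺ b) ℤ.* ⁺ c ℤ.+ ⁺ b ℤ.* (⁺ c ℤ.- ⁺ d) ≡ ⁺ (a * c) ℤ.- ⁺ (b * d)
    products = trans (expand (⁺ a) (⁺ b) (⁺ c) (⁺ d))
      (sym (cong₂ ℤ._-_ (ℤ.pos-* a c) (ℤ.pos-* b d)))

  +-congˡ-mod : ∀ {a b} c → a ≈ b [mod m ] → c + a ≈ c + b [mod m ]
  +-congˡ-mod c = +-cong-mod {a = c} mod-refl

  *-congˡ-mod : ∀ {a b} c → a ≈ b [mod m ] → c * a ≈ c * b [mod m ]
  *-congˡ-mod c = *-cong-mod {a = c} mod-refl

  *-congʳ-mod : ∀ {a b} c → a ≈ b [mod m ] → a * c ≈ b * c [mod m ]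
  *-congʳ-mod c h = *-cong-mod h mod-refl

  +-cancelʳ-mod : ∀ {a b} c → a + c ≈ b + c [mod m ] → a ≈ b [mod m ]
  +-cancelʳ-mod {a} {b} c (mod h) =
    mod (subst (m ∣_) (trans (cong₂ ∣_-_∣ (+-comm a c) (+-comm b c)) (∣m+n-m+o∣≡∣n-o∣ c a b)) h)

  ∣⇒≈0 : ∀ {x} → m ∣ x → x ≈ 0 [mod m ]
  ∣⇒≈0 {x} h = mod (subst (m ∣_) (sym (∣-∣-identityʳ x)) h)

  ≈0⇒∣ : ∀ {x} → x ≈ 0 [mod m ] → m ∣ x
  ≈0⇒∣ {x} (mod h) = subst (m ∣_) (∣-∣-identityʳ x) h

  +-multiple-mod : ∀ a k → a + k * m ≈ a [mod m ]
  +-multiple-mod a k = subst (a + k * m ≈_[mod m ]) (+-identityʳ a) (+-congˡ-mod a (∣⇒≈0 (n∣m*n k)))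

  mod-weaken : ∀ {n a b} → m ∣ n → a ≈ b [mod n ] → a ≈ b [mod m ]
  mod-weaken m∣n (mod h) = mod (∣-trans m∣n h)

  ¬∣-resp-mod : ∀ {a b} → a ≈ b [mod m ] → ¬ m ∣ b → ¬ m ∣ a
  ¬∣-resp-mod a≈b m∤b m∣a = m∤b (≈0⇒∣ (mod-trans (mod-sym a≈b) (∣⇒≈0 m∣a)))

  inverse-unique : ∀ {x y z} → x * y ≈ 1 [mod m ] → x * z ≈ 1 [mod m ] → y ≈ z [mod m ]
  inverse-unique {x} {y} {z} xy≈1 xz≈1 = begin
    y           ≡⟨ *-identityʳ y ⟨
    y * 1       ≈⟨ *-congˡ-mod y (mod-sym xz≈1) ⟩
    y * (x * z) ≡⟨ solve (x ∷ y ∷ z ∷ []) ⟩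
    x * y * z   ≈⟨ *-congʳ-mod z xy≈1 ⟩
    1 * z       ≡⟨ *-identityˡ z ⟩
    z           ∎
    where open ≈-mod-Reasoning m

2*n≡n+n : ∀ n → 2 * n ≡ n + n
2*n≡n+n = solve-∀

-- Units modulo powers of a prime

¬∣-< : ∀ {p r} → 0 < r → r < p → ¬ p ∣ r
¬∣-< 0<r r<p p∣r = <⇒≱ r<p (∣⇒≤ {{>-nonZero 0<r}} p∣r)

-- In the +- case x * y ≡ -1 (mod p).
Bézout-inverse : ∀ {p x} → Bézout.Identity 1 p x → ℕ
Bézout-inverse {p} (Bézout.+- _ y _) = y * (p ∸ 1)
Bézout-inverse     (Bézout.-+ _ y _) = y

module _ {p : ℕ} (p-prime : Prime p) where

  ¬∣1 : ¬ p ∣ 1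
  ¬∣1 p∣1 = ¬prime[1] (subst Prime (∣1⇒≡1 p∣1) p-prime)

  ¬∣-* : ∀ {a b} → ¬ p ∣ a → ¬ p ∣ b → ¬ p ∣ a * b
  ¬∣-* {a} {b} p∤a p∤b p∣ab with euclidsLemma a b p-prime p∣ab
  ... | inj₁ p∣a = p∤a p∣a
  ... | inj₂ p∣b = p∤b p∣b

  ∣-cancelˡ : ∀ {c x} → ¬ p ∣ c → p ∣ c * x → p ∣ x
  ∣-cancelˡ {c} {x} p∤c p∣cx with euclidsLemma c x p-prime p∣cx
  ... | inj₁ p∣c = ⊥-elim (p∤c p∣c)
  ... | inj₂ p∣x = p∣x

  ¬∣-^ : ∀ {a} → ¬ p ∣ a → ∀ k → ¬ p ∣ a ^ k
  ¬∣-^ p∤a zero    = ¬∣1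
  ¬∣-^ p∤a (suc k) = ¬∣-* p∤a (¬∣-^ p∤a k)

  ¬∣-! : ∀ {n} → n < p → ¬ p ∣ n !
  ¬∣-! {zero}  _   = ¬∣1
  ¬∣-! {suc n} n<p = ¬∣-* (¬∣-< z<s n<p) (¬∣-! (<-trans (n<1+n n) n<p))

  ∣-cancelˡ-^ : ∀ e {c x} → ¬ p ∣ c → p ^ e ∣ c * x → p ^ e ∣ x
  ∣-cancelˡ-^ zero    {x = x} _ _ = 1∣ x
  ∣-cancelˡ-^ (suc e) {c} {x} p∤c pᵉ⁺¹∣cx with euclidsLemma c x p-prime (∣-trans (m∣m*n (p ^ e)) pᵉ⁺¹∣cx)
  ... | inj₁ p∣c = ⊥-elim (p∤c p∣c)
  ... | inj₂ (divides y refl) = subst (_∣ y * p) (*-comm (p ^ e) p)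
    (*-monoˡ-∣ p (∣-cancelˡ-^ e p∤c (*-cancelʳ-∣ p {{prime⇒nonZero p-prime}} pᵉ*p∣cy*p)))
    where
    pᵉ*p∣cy*p : p ^ e * p ∣ c * y * p
    pᵉ*p∣cy*p = subst₂ _∣_ (*-comm p (p ^ e)) (sym (*-assoc c y p)) pᵉ⁺¹∣cx

  *-cancelˡ-mod : ∀ e {c a b} → ¬ p ∣ c → c * a ≈ c * b [mod p ^ e ] → a ≈ b [mod p ^ e ]
  *-cancelˡ-mod e {c} {a} {b} p∤c (mod h) =
    mod (∣-cancelˡ-^ e p∤c (subst (p ^ e ∣_) (sym (*-distribˡ-∣-∣ c a b)) h))

  square-root-mod : ∀ e {x y} → ¬ p ∣ 2 → ¬ p ∣ y →
                    x ≈ y [mod p ] → x * x ≈ y * y [mod p ^ e ] → x ≈ y [mod p ^ e ]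
  square-root-mod e {x} {y} p∤2 p∤y x≈y x²≈y² = *-cancelˡ-mod e p∤x+y (begin
    (x + y) * x     ≡⟨ solve (x ∷ y ∷ []) ⟩
    x * x + x * y   ≈⟨ +-cong-mod x²≈y² mod-refl ⟩
    y * y + x * y   ≡⟨ solve (x ∷ y ∷ []) ⟩
    (x + y) * y     ∎)
    where
    open ≈-mod-Reasoning (p ^ e)
    p∤x+y : ¬ p ∣ x + y
    p∤x+y = ¬∣-resp-mod (+-cong-mod x≈y (mod-refl {a = y}))
      (subst (λ z → ¬ p ∣ z) (2*n≡n+n y) (¬∣-* p∤2 p∤y))

  ¬∣⇒coprime : ∀ {x} → ¬ p ∣ x → Coprime p x
  ¬∣⇒coprime p∤x (d∣p , d∣x) with prime⇒irreducible p-prime d∣p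
  ... | inj₁ d≡1 = d≡1
  ... | inj₂ refl = ⊥-elim (p∤x d∣x)

  *-Bézout-inverse : ∀ {x} (b : Bézout.Identity 1 p x) → x * Bézout-inverse b ≈ 1 [mod p ]
  *-Bézout-inverse {x} (Bézout.-+ a y eq) = begin
    x * y     ≡⟨ trans (*-comm x y) (sym eq) ⟩
    1 + a * p ≈⟨ +-multiple-mod 1 a ⟩
    1         ∎
    where open ≈-mod-Reasoning p
  *-Bézout-inverse {x} (Bézout.+- a y eq) = +-cancelʳ-mod (x * y) (begin
    x * (y * (p ∸ 1)) + x * y ≡⟨ factor x y (p ∸ 1) ⟩
    x * y * (p ∸ 1 + 1)       ≡⟨ cong (x * y *_) (m∸n+n≡m (>-nonZero⁻¹ p {{prime⇒nonZero p-prime}})) ⟩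
    0 + x * y * p             ≈⟨ +-multiple-mod 0 (x * y) ⟩
    0                         ≈⟨ mod-sym (+-multiple-mod 0 a) ⟩
    a * p                     ≡⟨ trans (sym eq) (cong (1 +_) (*-comm y x)) ⟩
    1 + x * y                 ∎)
    where
    open ≈-mod-Reasoning p
    factor : ∀ a b c → a * (b * c) + a * b ≡ a * b * (c + 1)
    factor = solve-∀

  inverse : ℕ → ℕ
  inverse x with coprime? p x
  ... | yes p⊥x = Bézout-inverse (coprime-Bézout p⊥x)
  ... | no  _   = 0

  *-inverse : ∀ {x} → ¬ p ∣ x → x * inverse x ≈ 1 [mod p ]
  *-inverse {x} p∤x with coprime? p x
  ... | yes p⊥x = *-Bézout-inverse (coprime-Bézout p⊥x)
  ... | no ¬p⊥x = ⊥-elim (¬p⊥x (¬∣⇒coprime p∤x))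

∏ : ℕ → (ℕ → ℕ) → ℕ
∏ zero    f = 1
∏ (suc n) f = ∏ n f * f (suc n)

∑ : ℕ → (ℕ → ℕ) → ℕ
∑ zero    f = 0
∑ (suc n) f = ∑ n f + f (suc n)

module _ {P : ℕ → Set} {n : ℕ} (P[1…n+1] : ∀ {r} → 0 < r → r ≤ suc n → P r) where

  restrict : ∀ {r} → 0 < r → r ≤ n → P r
  restrict 0<r r≤n = P[1…n+1] 0<r (m≤n⇒m≤1+n r≤n)

  last : P (suc n)
  last = P[1…n+1] z<s ≤-refl

∏-cong : ∀ n {f g} → (∀ {r} → 0 < r → r ≤ n → f r ≡ g r) → ∏ n f ≡ ∏ n g
∏-cong zero    _   = refl
∏-cong (suc n) f≡g = cong₂ _*_ (∏-cong n (restrict f≡g)) (last f≡g)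

∏-cong-mod : ∀ {m} n {f g} → (∀ {r} → 0 < r → r ≤ n → f r ≈ g r [mod m ]) → ∏ n f ≈ ∏ n g [mod m ]
∏-cong-mod zero    _   = mod-refl
∏-cong-mod (suc n) f≈g = *-cong-mod (∏-cong-mod n (restrict f≈g)) (last f≈g)

∑-cong : ∀ n {f g} → (∀ {r} → 0 < r → r ≤ n → f r ≡ g r) → ∑ n f ≡ ∑ n g
∑-cong zero    _   = refl
∑-cong (suc n) f≡g = cong₂ _+_ (∑-cong n (restrict f≡g)) (last f≡g)

∑-cong-mod : ∀ {m} n {f g} → (∀ {r} → 0 < r → r ≤ n → f r ≈ g r [mod m ]) → ∑ n f ≈ ∑ n g [mod m ]
∑-cong-mod zero    _   = mod-refl
∑-cong-mod (suc n) f≈g = +-cong-mod (∑-cong-mod n (restrict f≈g)) (last f≈g)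

∏-distrib-* : ∀ n f g → ∏ n (λ r → f r * g r) ≡ ∏ n f * ∏ n g
∏-distrib-* zero    f g = refl
∏-distrib-* (suc n) f g = trans (cong (_* (f (suc n) * g (suc n))) (∏-distrib-* n f g))
  (interchange (∏ n f) (∏ n g) (f (suc n)) (g (suc n)))
  where
  interchange : ∀ a b c d → a * b * (c * d) ≡ a * c * (b * d)
  interchange = solve-∀

∏-const : ∀ n c → ∏ n (λ _ → c) ≡ c ^ n
∏-const zero    c = refl
∏-const (suc n) c = trans (cong (_* c) (∏-const n c)) (*-comm (c ^ n) c)

∏-id : ∀ n → ∏ n (λ r → r) ≡ n !
∏-id zero    = refl
∏-id (suc n) = trans (cong (_* suc n) (∏-id n)) (*-comm (n !) (suc n))

∏-unfoldˡ : ∀ n f → ∏ (suc n) f ≡ f 1 * ∏ n (λ r → f (suc r))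
∏-unfoldˡ zero    f = *-comm 1 (f 1)
∏-unfoldˡ (suc n) f = trans (cong (_* f (2 + n)) (∏-unfoldˡ n f)) (*-assoc (f 1) _ _)

∏-reverse : ∀ n f → ∏ n f ≡ ∏ n (λ r → f (suc n ∸ r))
∏-reverse zero    f = refl
∏-reverse (suc n) f = begin
  ∏ n f * f (suc n)                         ≡⟨ cong (_* f (suc n)) (∏-reverse n f) ⟩
  ∏ n (λ r → f (suc n ∸ r)) * f (suc n)     ≡⟨ *-comm _ (f (suc n)) ⟩
  f (suc n) * ∏ n (λ r → f (suc n ∸ r))     ≡⟨ ∏-unfoldˡ n (λ r → f (2 + n ∸ r)) ⟨
  ∏ (suc n) (λ r → f (2 + n ∸ r))           ∎
  where open ≡-Reasoning

[m+n]!≡m!*∏ : ∀ m n → (m + n) ! ≡ m ! * ∏ n (m +_)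
[m+n]!≡m!*∏ m zero    = trans (cong _! (+-identityʳ m)) (sym (*-identityʳ (m !)))
[m+n]!≡m!*∏ m (suc n) = begin
  (m + suc n) !                           ≡⟨ cong _! (+-suc m n) ⟩
  suc (m + n) * (m + n) !                 ≡⟨ cong (suc (m + n) *_) ([m+n]!≡m!*∏ m n) ⟩
  suc (m + n) * (m ! * ∏ n (m +_))        ≡⟨ rotate (suc (m + n)) (m !) (∏ n (m +_)) ⟩
  m ! * (∏ n (m +_) * suc (m + n))        ≡⟨ cong (λ k → m ! * (∏ n (m +_) * k)) (+-suc m n) ⟨
  m ! * ∏ (suc n) (m +_)                  ∎
  where
  open ≡-Reasoning
  rotate : ∀ a b c → a * (b * c) ≡ b * (c * a)
  rotate = solve-∀

∑-distrib-+ : ∀ n f g → ∑ n (λ r → f r + g r) ≡ ∑ n f + ∑ n g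
∑-distrib-+ zero    f g = refl
∑-distrib-+ (suc n) f g = trans (cong (_+ (f (suc n) + g (suc n))) (∑-distrib-+ n f g))
  (interchange (∑ n f) (∑ n g) (f (suc n)) (g (suc n)))
  where
  interchange : ∀ a b c d → a + b + (c + d) ≡ a + c + (b + d)
  interchange = solve-∀

*-distribˡ-∑ : ∀ c n f → c * ∑ n f ≡ ∑ n (λ r → c * f r)
*-distribˡ-∑ c zero    f = *-zeroʳ c
*-distribˡ-∑ c (suc n) f = trans (*-distribˡ-+ c (∑ n f) (f (suc n))) (cong (_+ c * f (suc n)) (*-distribˡ-∑ c n f))

∑-split : ∀ m n f → ∑ (m + n) f ≡ ∑ m f + ∑ n (λ r → f (m + r))
∑-split m zero    f = trans (cong (λ k → ∑ k f) (+-identityʳ m)) (sym (+-identityʳ (∑ m f)))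
∑-split m (suc n) f = begin
  ∑ (m + suc n) f                                   ≡⟨ cong (λ k → ∑ k f) (+-suc m n) ⟩
  ∑ (m + n) f + f (suc (m + n))                     ≡⟨ cong₂ _+_ (∑-split m n f) (cong f (sym (+-suc m n))) ⟩
  ∑ m f + ∑ n (λ r → f (m + r)) + f (m + suc n)     ≡⟨ +-assoc (∑ m f) _ _ ⟩
  ∑ m f + ∑ (suc n) (λ r → f (m + r))               ∎
  where open ≡-Reasoning

∑-pairs : ∀ n f → ∑ (n + n) f ≡ ∑ n (λ r → f (r + r ∸ 1) + f (r + r))
∑-pairs zero    f = refl
∑-pairs (suc n) f = begin
  ∑ (suc n + suc n) f                                       ≡⟨ cong (λ k → ∑ (suc k) f) (+-suc n n) ⟩
  ∑ (n + n) f + f (suc (n + n)) + f (2 + (n + n))           ≡⟨ +-assoc (∑ (n + n) f) _ _ ⟩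
  ∑ (n + n) f + (f (suc (n + n)) + f (2 + (n + n)))         ≡⟨ cong₂ _+_ (∑-pairs n f)
                                                                 (cong₂ _+_ (cong f (sym (+-suc n n))) (cong (f ∘ suc) (sym (+-suc n n)))) ⟩
  ∑ (suc n) (λ r → f (r + r ∸ 1) + f (r + r))               ∎
  where open ≡-Reasoning

3*∑pronic+n≡n³ : ∀ n → 3 * ∑ n (λ t → pred t * t) + n ≡ n * n * n
3*∑pronic+n≡n³ zero    = refl
3*∑pronic+n≡n³ (suc n) = begin
  3 * (S + n * suc n) + suc n            ≡⟨ expand S n ⟩
  (3 * S + n) + 3 * n * n + 3 * n + 1    ≡⟨ cong (λ x → x + 3 * n * n + 3 * n + 1) (3*∑pronic+n≡n³ n) ⟩
  n * n * n + 3 * n * n + 3 * n + 1      ≡⟨ solve (n ∷ []) ⟩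
  suc n * suc n * suc n                  ∎
  where
  open ≡-Reasoning
  S : ℕ
  S = ∑ n (λ t → pred t * t)
  expand : ∀ s n → 3 * (s + n * suc n) + suc n ≡ (3 * s + n) + 3 * n * n + 3 * n + 1
  expand = solve-∀

-- First-order expansion of a product

-- linearCoeff f g n = ∑ᵣ g r * ∏_{s ≠ r} f s
linearCoeff : (f g : ℕ → ℕ) → ℕ → ℕ
linearCoeff f g zero    = 0
linearCoeff f g (suc n) = linearCoeff f g n * f (suc n) + ∏ n f * g (suc n)

∏-linearise : ∀ f g v n → ∏ n (λ r → f r + v * g r) ≈ ∏ n f + v * linearCoeff f g n [mod v * v ]
∏-linearise f g v zero    = mod-reflexive (cong suc (sym (*-zeroʳ v)))
∏-linearise f g v (suc n) = begin
  ∏ n (λ r → f r + v * g r) * (f′ + v * g′)                  ≈⟨ *-congʳ-mod _ (∏-linearise f g v n) ⟩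
  (∏ n f + v * L) * (f′ + v * g′)                             ≡⟨ expand (∏ n f) L f′ g′ v ⟩
  ∏ n f * f′ + v * (L * f′ + ∏ n f * g′) + L * g′ * (v * v)   ≈⟨ +-multiple-mod _ (L * g′) ⟩
  ∏ (suc n) f + v * linearCoeff f g (suc n)                   ∎
  where
  open ≈-mod-Reasoning (v * v)
  f′ : ℕ
  f′ = f (suc n)
  g′ : ℕ
  g′ = g (suc n)
  L : ℕ
  L = linearCoeff f g n
  expand : ∀ a l x y v → (a + v * l) * (x + v * y) ≡ a * x + v * (l * x + a * y) + l * y * (v * v)
  expand = solve-∀

*-linearCoeff : ∀ {m K} (f g c : ℕ → ℕ) n → (∀ {r} → 0 < r → r ≤ n → f r * c r ≈ K [mod m ]) →
                K * linearCoeff f g n ≈ ∏ n f * ∑ n (λ r → g r * c r) [mod m ]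
*-linearCoeff {K = K} f g c zero    _     = mod-reflexive (*-zeroʳ K)
*-linearCoeff {m} {K} f g c (suc n) fc≈K = begin
  K * (L * f′ + ∏ n f * g′)                ≡⟨ distribute K L f′ (∏ n f) g′ ⟩
  K * L * f′ + ∏ n f * g′ * K              ≈⟨ +-cong-mod (*-congʳ-mod f′ (*-linearCoeff {m} {K} f g c n (restrict fc≈K)))
                                                          (*-congˡ-mod (∏ n f * g′) (mod-sym (last fc≈K))) ⟩
  ∏ n f * S * f′ + ∏ n f * g′ * (f′ * c′)  ≡⟨ collect (∏ n f) S f′ g′ c′ ⟩
  ∏ n f * f′ * (S + g′ * c′)               ∎
  where
  open ≈-mod-Reasoning m
  f′ : ℕ
  f′ = f (suc n)
  g′ : ℕ
  g′ = g (suc n)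
  c′ : ℕ
  c′ = c (suc n)
  L : ℕ
  L = linearCoeff f g n
  S : ℕ
  S = ∑ n (λ r → g r * c r)
  distribute : ∀ k l x a y → k * (l * x + a * y) ≡ k * l * x + a * y * k
  distribute = solve-∀
  collect : ∀ a s x y z → a * s * x + a * y * (x * z) ≡ a * x * (s + y * z)
  collect = solve-∀

nCk*k!*[n∸k]!≡n! : ∀ {n k} → k ≤ n → (n C k) * (k ! * (n ∸ k) !) ≡ n !
nCk*k!*[n∸k]!≡n! {n} {k} k≤n = trans (cong (_* (k ! * (n ∸ k) !)) (nCk≡n!/k![n-k]! k≤n)) (m/n*n≡m (k![n∸k]!∣n! k≤n))
  where instance _ = k !* (n ∸ k) !≢0

[1+k]*[1+n]C[1+k]≡[1+n]*nCk : ∀ n k → suc k * (suc n C suc k) ≡ suc n * (n C k)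
[1+k]*[1+n]C[1+k]≡[1+n]*nCk n k with k ≤? n
... | no  k≰n = begin
  suc k * (suc n C suc k)   ≡⟨ cong (suc k *_) (k>n⇒nCk≡0 (s<s (≰⇒> k≰n))) ⟩
  suc k * 0                 ≡⟨ *-zeroʳ (suc k) ⟩
  0                         ≡⟨ *-zeroʳ (suc n) ⟨
  suc n * 0                 ≡⟨ cong (suc n *_) (k>n⇒nCk≡0 (≰⇒> k≰n)) ⟨
  suc n * (n C k)           ∎
  where open ≡-Reasoning
... | yes k≤n = *-cancelʳ-≡ _ _ (k ! * (n ∸ k) !) {{k !* (n ∸ k) !≢0}} (begin
  suc k * (suc n C suc k) * (k ! * (n ∸ k) !)   ≡⟨ regroup (suc k) (suc n C suc k) (k !) ((n ∸ k) !) ⟩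
  (suc n C suc k) * (suc k ! * (n ∸ k) !)       ≡⟨ nCk*k!*[n∸k]!≡n! (s≤s k≤n) ⟩
  suc n !                                       ≡⟨ cong (suc n *_) (nCk*k!*[n∸k]!≡n! k≤n) ⟨
  suc n * ((n C k) * (k ! * (n ∸ k) !))         ≡⟨ *-assoc (suc n) (n C k) _ ⟨
  suc n * (n C k) * (k ! * (n ∸ k) !)           ∎)
  where
  open ≡-Reasoning
  regroup : ∀ s c a b → s * c * (a * b) ≡ c * (s * a * b)
  regroup = solve-∀

-- Blocks of p consecutive integers

module Blocks (q : ℕ) where

  p : ℕ
  p = suc q

  block : ℕ → ℕ
  block t = ∏ q (λ r → t * p + r)

  blocks : ℕ → ℕ
  blocks k = ∏ k (λ t → block (pred t))

  [k*p]!≡blocks*p^k*k! : ∀ k → (k * p) ! ≡ blocks k * (p ^ k * k !)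
  [k*p]!≡blocks*p^k*k! zero    = refl
  [k*p]!≡blocks*p^k*k! (suc k) = begin
    (p + k * p) !                                      ≡⟨ cong _! (+-comm p (k * p)) ⟩
    (k * p + p) !                                      ≡⟨ [m+n]!≡m!*∏ (k * p) p ⟩
    (k * p) ! * (block k * (k * p + p))                ≡⟨ cong (_* (block k * (k * p + p))) ([k*p]!≡blocks*p^k*k! k) ⟩
    blocks k * (p ^ k * k !) * (block k * (k * p + p)) ≡⟨ regroup (blocks k) (block k) p (p ^ k) (k !) k ⟩
    blocks k * block k * (p * p ^ k * ((1 + k) * k !)) ∎
    where
    open ≡-Reasoning
    regroup : ∀ d b p pᵏ k! k → d * (pᵏ * k!) * (b * (k * p + p)) ≡ d * b * (p * pᵏ * ((1 + k) * k!))
    regroup = solve-∀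

  [np]C[mp]*blocks≡blocks*nCm : ∀ {n m} → m ≤ n →
    ((n * p) C (m * p)) * (blocks m * blocks (n ∸ m)) ≡ blocks n * (n C m)
  [np]C[mp]*blocks≡blocks*nCm {n} {m} m≤n = *-cancelʳ-≡ _ _ (p ^ n * (m ! * (n ∸ m) !)) {{pⁿm![n∸m]!≢0}} (begin
    C′ * (bₘ * bₙ₋ₘ) * (p ^ n * (m ! * (n ∸ m) !))
      ≡⟨ cong (λ x → C′ * (bₘ * bₙ₋ₘ) * (x * (m ! * (n ∸ m) !))) pⁿ≡pᵐ*pⁿ⁻ᵐ ⟩
    C′ * (bₘ * bₙ₋ₘ) * (p ^ m * p ^ (n ∸ m) * (m ! * (n ∸ m) !))
      ≡⟨ regroup C′ bₘ bₙ₋ₘ (p ^ m) (p ^ (n ∸ m)) (m !) ((n ∸ m) !) ⟩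
    C′ * (bₘ * (p ^ m * m !) * (bₙ₋ₘ * (p ^ (n ∸ m) * (n ∸ m) !)))
      ≡⟨ cong₂ (λ x y → C′ * (x * y)) ([k*p]!≡blocks*p^k*k! m) ([k*p]!≡blocks*p^k*k! (n ∸ m)) ⟨
    C′ * ((m * p) ! * ((n ∸ m) * p) !)
      ≡⟨ cong (λ x → C′ * ((m * p) ! * x !)) (*-distribʳ-∸ p n m) ⟩
    C′ * ((m * p) ! * (n * p ∸ m * p) !)
      ≡⟨ nCk*k!*[n∸k]!≡n! (*-monoˡ-≤ p m≤n) ⟩
    (n * p) !
      ≡⟨ [k*p]!≡blocks*p^k*k! n ⟩
    blocks n * (p ^ n * n !)
      ≡⟨ cong (λ x → blocks n * (p ^ n * x)) (nCk*k!*[n∸k]!≡n! m≤n) ⟨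
    blocks n * (p ^ n * ((n C m) * (m ! * (n ∸ m) !)))
      ≡⟨ regroup′ (blocks n) (p ^ n) (n C m) (m ! * (n ∸ m) !) ⟩
    blocks n * (n C m) * (p ^ n * (m ! * (n ∸ m) !)) ∎)
    where
    open ≡-Reasoning
    C′ : ℕ
    C′ = (n * p) C (m * p)
    bₘ : ℕ
    bₘ = blocks m
    bₙ₋ₘ : ℕ
    bₙ₋ₘ = blocks (n ∸ m)
    pⁿm![n∸m]!≢0 : NonZero (p ^ n * (m ! * (n ∸ m) !))
    pⁿm![n∸m]!≢0 = m*n≢0 (p ^ n) _ {{m^n≢0 p n}} {{m !* (n ∸ m) !≢0}}
    pⁿ≡pᵐ*pⁿ⁻ᵐ : p ^ n ≡ p ^ m * p ^ (n ∸ m)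
    pⁿ≡pᵐ*pⁿ⁻ᵐ = trans (cong (p ^_) (sym (m+[n∸m]≡n m≤n))) (^-distribˡ-+-* p m (n ∸ m))
    regroup : ∀ c x y a b u w → c * (x * y) * (a * b * (u * w)) ≡ c * (x * (a * u) * (y * (b * w)))
    regroup = solve-∀
    regroup′ : ∀ b a c d → b * (a * (c * d)) ≡ b * c * (a * d)
    regroup′ = solve-∀

  blocksCoeff : ℕ → ℕ
  blocksCoeff = linearCoeff (λ _ → q ! * q !) (λ t → pred t * t)

  pairProduct : ℕ → ℕ
  pairProduct r = r * (p ∸ r)

  -- pairCoeff ≡ -(q!)² ∑ 1/r² (mod p), as pairProduct r ≡ -r².
  pairCoeff : ℕ
  pairCoeff = linearCoeff pairProduct (λ _ → 1) q

  defect : ℕ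
  defect = p * p * pairCoeff

  ∏pairProduct≡q!*q! : ∏ q pairProduct ≡ q ! * q !
  ∏pairProduct≡q!*q! = begin
    ∏ q pairProduct                                 ≡⟨ ∏-distrib-* q (λ r → r) (p ∸_) ⟩
    ∏ q (λ r → r) * ∏ q (p ∸_)                      ≡⟨ cong (∏ q (λ r → r) *_) (∏-reverse q (p ∸_)) ⟩
    ∏ q (λ r → r) * ∏ q (λ r → p ∸ (p ∸ r))         ≡⟨ cong (∏ q (λ r → r) *_) (∏-cong q p∸[p∸r]≡r) ⟩
    ∏ q (λ r → r) * ∏ q (λ r → r)                   ≡⟨ cong₂ _*_ (∏-id q) (∏-id q) ⟩
    q ! * q !                                       ∎
    where
    open ≡-Reasoning
    p∸[p∸r]≡r : ∀ {r} → 0 < r → r ≤ q → p ∸ (p ∸ r) ≡ r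
    p∸[p∸r]≡r _ r≤q = m∸[m∸n]≡n (m≤n⇒m≤1+n r≤q)

  block*block : ∀ t → block t * block t ≡ ∏ q (λ r → pairProduct r + p * p * (t * suc t) * 1)
  block*block t = begin
    block t * block t                                      ≡⟨ cong (block t *_) (∏-reverse q (λ r → t * p + r)) ⟩
    block t * ∏ q (λ r → t * p + (p ∸ r))                  ≡⟨ ∏-distrib-* q (λ r → t * p + r) (λ r → t * p + (p ∸ r)) ⟨
    ∏ q (λ r → (t * p + r) * (t * p + (p ∸ r)))            ≡⟨ ∏-cong q (λ _ r≤q → pair (m≤n⇒m≤1+n r≤q)) ⟩
    ∏ q (λ r → pairProduct r + p * p * (t * suc t) * 1)    ∎
    where
    open ≡-Reasoning
    expand : ∀ t r s → (t * (r + s) + r) * (t * (r + s) + s) ≡ r * s + (r + s) * (r + s) * (t * (1 + t)) * 1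
    expand = solve-∀
    pair : ∀ {r} → r ≤ p → (t * p + r) * (t * p + (p ∸ r)) ≡ pairProduct r + p * p * (t * suc t) * 1
    pair {r} r≤p = subst (λ n → (t * n + r) * (t * n + (p ∸ r)) ≡ r * (p ∸ r) + n * n * (t * suc t) * 1)
      (m+[n∸m]≡n r≤p) (expand t r (p ∸ r))

  block-square : ∀ t → block t * block t ≈ q ! * q ! + t * suc t * defect [mod p ^ 4 ]
  block-square t = begin
    block t * block t                                     ≡⟨ block*block t ⟩
    ∏ q (λ r → pairProduct r + v * 1)                     ≈⟨ mod-weaken p⁴∣v*v (∏-linearise pairProduct (λ _ → 1) v q) ⟩
    ∏ q pairProduct + v * pairCoeff                       ≡⟨ cong₂ _+_ ∏pairProduct≡q!*q! (regroup p (t * suc t) _) ⟩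
    q ! * q ! + t * suc t * defect                        ∎
    where
    open ≈-mod-Reasoning (p ^ 4)
    v : ℕ
    v = p * p * (t * suc t)
    square : ∀ p x → p * p * x * (p * p * x) ≡ x * x * (p * (p * (p * (p * 1))))
    square = solve-∀
    p⁴∣v*v : p ^ 4 ∣ v * v
    p⁴∣v*v = divides (t * suc t * (t * suc t)) (square p (t * suc t))
    regroup : ∀ p x c → p * p * x * c ≡ x * (p * p * c)
    regroup = solve-∀

  block≈q! : ∀ t → block t ≈ q ! [mod p ]
  block≈q! t = begin
    ∏ q (λ r → t * p + r) ≈⟨ ∏-cong-mod q (λ {r} _ _ → subst (_≈ r [mod p ]) (+-comm r (t * p)) (+-multiple-mod r t)) ⟩
    ∏ q (λ r → r)         ≡⟨ ∏-id q ⟩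
    q !                   ∎
    where open ≈-mod-Reasoning p

  blocks≈q!^-mod-p : ∀ k → blocks k ≈ (q !) ^ k [mod p ]
  blocks≈q!^-mod-p k = begin
    ∏ k (λ t → block (pred t)) ≈⟨ ∏-cong-mod k (λ {t} _ _ → block≈q! (pred t)) ⟩
    ∏ k (λ _ → q !)            ≡⟨ ∏-const k (q !) ⟩
    (q !) ^ k                  ∎
    where open ≈-mod-Reasoning p

  [q+p]Cq*q!≡block1 : ((q + p) C q) * q ! ≡ block 1
  [q+p]Cq*q!≡block1 = *-cancelʳ-≡ _ _ (p !) {{p !≢0}} (begin
    ((q + p) C q) * q ! * p !                   ≡⟨ *-assoc ((q + p) C q) (q !) (p !) ⟩
    ((q + p) C q) * (q ! * p !)                 ≡⟨ cong (λ x → ((q + p) C q) * (q ! * x !)) (m+n∸m≡n q p) ⟨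
    ((q + p) C q) * (q ! * (q + p ∸ q) !)       ≡⟨ nCk*k!*[n∸k]!≡n! (m≤m+n q p) ⟩
    (q + p) !                                   ≡⟨ cong _! (+-comm q p) ⟩
    (p + q) !                                   ≡⟨ [m+n]!≡m!*∏ p q ⟩
    p ! * ∏ q (p +_)                            ≡⟨ cong (p ! *_) (∏-cong q (λ {r} _ _ → cong (_+ r) (sym (*-identityˡ p)))) ⟩
    p ! * block 1                               ≡⟨ *-comm (p !) (block 1) ⟩
    block 1 * p !                               ∎)
    where open ≡-Reasoning

  wolstenholme⇒block1≈q! : IsWolstenholme p → block 1 ≈ q ! [mod p ^ 4 ]
  wolstenholme⇒block1≈q! wolstenholme = begin
    block 1                   ≡⟨ [q+p]Cq*q!≡block1 ⟨
    ((q + p) C q) * q !       ≈⟨ *-congʳ-mod (q !) (mod {a = (q + p) C q} wolstenholme) ⟩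
    1 * q !                   ≡⟨ *-identityˡ (q !) ⟩
    q !                       ∎
    where open ≈-mod-Reasoning (p ^ 4)

  [p+p]Cp≡[q+p]Cq+[q+p]Cq : (p + p) C p ≡ (q + p) C q + (q + p) C q
  [p+p]Cp≡[q+p]Cq+[q+p]Cq = begin
    suc (q + p) C p                     ≡⟨ nCk+nC[k+1]≡[n+1]C[k+1] (q + p) q ⟨
    (q + p) C q + (q + p) C p           ≡⟨ cong ((q + p) C q +_) (nCk≡nC[n∸k] (m≤n+m p q)) ⟩
    (q + p) C q + (q + p) C (q + p ∸ p) ≡⟨ cong (λ k → (q + p) C q + (q + p) C k) (m+n∸n≡m q p) ⟩
    (q + p) C q + (q + p) C q           ∎
    where open ≡-Reasoning

  blocks-square : ∀ k → p ^ 4 ∣ defect * defect →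
                  blocks k * blocks k ≈ (q !) ^ k * (q !) ^ k + defect * blocksCoeff k [mod p ^ 4 ]
  blocks-square k p⁴∣defect² = begin
    blocks k * blocks k                                     ≡⟨ ∏-distrib-* k (block ∘ pred) (block ∘ pred) ⟨
    ∏ k (λ t → block (pred t) * block (pred t))             ≈⟨ ∏-cong-mod k block-square′ ⟩
    ∏ k (λ t → q ! * q ! + defect * (pred t * t))           ≈⟨ mod-weaken p⁴∣defect² linearise ⟩
    ∏ k (λ _ → q ! * q !) + defect * blocksCoeff k          ≡⟨ cong (_+ defect * blocksCoeff k) ∏G≡ ⟩
    (q !) ^ k * (q !) ^ k + defect * blocksCoeff k          ∎
    where
    open ≈-mod-Reasoning (p ^ 4)
    linearise : ∏ k (λ t → q ! * q ! + defect * (pred t * t)) ≈ ∏ k (λ _ → q ! * q !) + defect * blocksCoeff k [mod defect * defect ]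
    linearise = ∏-linearise (λ _ → q ! * q !) (λ t → pred t * t) defect k
    block-square′ : ∀ {t} → 0 < t → t ≤ k → block (pred t) * block (pred t) ≈ q ! * q ! + defect * (pred t * t) [mod p ^ 4 ]
    block-square′ {suc t} _ _ = subst (λ x → block t * block t ≈ q ! * q ! + x [mod p ^ 4 ]) (*-comm (t * suc t) defect) (block-square t)
    ∏G≡ : ∏ k (λ _ → q ! * q !) ≡ (q !) ^ k * (q !) ^ k
    ∏G≡ = trans (∏-distrib-* k (λ _ → q !) (λ _ → q !)) (cong₂ _*_ (∏-const k (q !)) (∏-const k (q !)))

  module _ (p-prime : Prime p) where

    pᵉ∣nCk : ∀ e {n k} → p ^ e ∣ n → ¬ p ∣ k → p ^ e ∣ n C k
    pᵉ∣nCk e         {k = zero}  _    p∤0 = ⊥-elim (p∤0 (p ∣0))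
    pᵉ∣nCk e {zero}  {suc k}     _    _   = (p ^ e) ∣0
    pᵉ∣nCk e {suc n} {suc k}     pᵉ∣n p∤k = ∣-cancelˡ-^ p-prime e p∤k
      (subst (p ^ e ∣_) (sym ([1+k]*[1+n]C[1+k]≡[1+n]*nCk n k)) (∣m⇒∣m*n (n C k) pᵉ∣n))

    lucas : ∀ e {N} → p ^ e ∣ N → ∀ n u v → n < p → v < p →
            (N + n) C (u * p + v) ≈ (N C (u * p)) * (n C v) [mod p ^ e ]
    lucas e {N} _    zero    u zero    _   _   = mod-reflexive (trans (cong₂ _C_ (+-identityʳ N) (+-identityʳ (u * p)))
                                                                     (sym (*-identityʳ _)))
    lucas e {N} pᵉ∣N zero    u (suc v) _   v<p = begin
      (N + 0) C (u * p + suc v)       ≈⟨ ∣⇒≈0 (pᵉ∣nCk e (subst (p ^ e ∣_) (sym (+-identityʳ N)) pᵉ∣N) p∤up+v) ⟩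
      0                               ≡⟨ *-zeroʳ (N C (u * p)) ⟨
      (N C (u * p)) * 0               ∎
      where
      open ≈-mod-Reasoning (p ^ e)
      p∤up+v : ¬ p ∣ u * p + suc v
      p∤up+v p∣up+v = ¬∣-< z<s v<p (∣m+n∣m⇒∣n p∣up+v (n∣m*n u))
    lucas e {N} pᵉ∣N (suc n) u (suc v) n<p v<p = begin
      (N + suc n) C (u * p + suc v)                         ≡⟨ cong₂ _C_ (+-suc N n) (+-suc (u * p) v) ⟩
      suc (N + n) C suc (u * p + v)                         ≡⟨ nCk+nC[k+1]≡[n+1]C[k+1] (N + n) (u * p + v) ⟨
      (N + n) C (u * p + v) + (N + n) C suc (u * p + v)     ≡⟨ cong (λ k → (N + n) C (u * p + v) + (N + n) C k) (+-suc (u * p) v) ⟨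
      (N + n) C (u * p + v) + (N + n) C (u * p + suc v)     ≈⟨ +-cong-mod (lucas e pᵉ∣N n u v n<p′ (<-trans (n<1+n v) v<p))
                                                                          (lucas e pᵉ∣N n u (suc v) n<p′ v<p) ⟩
      X * (n C v) + X * (n C suc v)                         ≡⟨ *-distribˡ-+ X (n C v) (n C suc v) ⟨
      X * ((n C v) + (n C suc v))                           ≡⟨ cong (X *_) (nCk+nC[k+1]≡[n+1]C[k+1] n v) ⟩
      X * (suc n C suc v)                                   ∎
      where
      open ≈-mod-Reasoning (p ^ e)
      X : ℕ
      X = N C (u * p)
      n<p′ : n < p
      n<p′ = <-trans (n<1+n n) n<p
    lucas e {N} pᵉ∣N (suc n) zero    zero n<p _ = mod-refl
    lucas e {N} pᵉ∣N (suc n) (suc u) zero n<p _ = begin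
      (N + suc n) C (suc u * p + 0)                         ≡⟨ cong₂ _C_ (+-suc N n) (trans (+-identityʳ _) (cong suc (+-comm q (u * p)))) ⟩
      suc (N + n) C suc (u * p + q)                         ≡⟨ nCk+nC[k+1]≡[n+1]C[k+1] (N + n) (u * p + q) ⟨
      (N + n) C (u * p + q) + (N + n) C suc (u * p + q)     ≡⟨ cong (λ k → (N + n) C (u * p + q) + (N + n) C k) p+up≡ ⟩
      (N + n) C (u * p + q) + (N + n) C (suc u * p + 0)     ≈⟨ +-cong-mod (lucas e pᵉ∣N n u q n<p′ ≤-refl)
                                                                          (lucas e pᵉ∣N n (suc u) zero n<p′ z<s) ⟩
      (N C (u * p)) * (n C q) + (N C (suc u * p)) * 1       ≡⟨ cong (λ x → (N C (u * p)) * x + (N C (suc u * p)) * 1) (k>n⇒nCk≡0 (s≤s⁻¹ n<p)) ⟩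
      (N C (u * p)) * 0 + (N C (suc u * p)) * 1             ≡⟨ cong (_+ (N C (suc u * p)) * 1) (*-zeroʳ (N C (u * p))) ⟩
      (N C (suc u * p)) * 1                                 ∎
      where
      open ≈-mod-Reasoning (p ^ e)
      n<p′ : n < p
      n<p′ = <-trans (n<1+n n) n<p
      p+up≡ : suc (u * p + q) ≡ suc u * p + 0
      p+up≡ = trans (cong suc (+-comm (u * p) q)) (sym (+-identityʳ _))

    p∤q! : ¬ p ∣ q !
    p∤q! = ¬∣-! p-prime (n<1+n q)

    [np]C[mp]≈nCm : ∀ e {n m} → m ≤ n →
                    blocks m ≈ (q !) ^ m [mod p ^ e ] →
                    blocks (n ∸ m) ≈ (q !) ^ (n ∸ m) [mod p ^ e ] →
                    blocks n ≈ (q !) ^ n [mod p ^ e ] →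
                    (n * p) C (m * p) ≈ n C m [mod p ^ e ]
    [np]C[mp]≈nCm e {n} {m} m≤n bₘ≈ bₙ₋ₘ≈ bₙ≈ = *-cancelˡ-mod p-prime e (¬∣-^ p-prime p∤q! n) (begin
      (q !) ^ n * C′                            ≡⟨ cong (_* C′) q!ⁿ≡q!ᵐ*q!ⁿ⁻ᵐ ⟩
      (q !) ^ m * (q !) ^ (n ∸ m) * C′          ≡⟨ *-comm _ C′ ⟩
      C′ * ((q !) ^ m * (q !) ^ (n ∸ m))        ≈⟨ *-congˡ-mod C′ (*-cong-mod (mod-sym bₘ≈) (mod-sym bₙ₋ₘ≈)) ⟩
      C′ * (blocks m * blocks (n ∸ m))          ≡⟨ [np]C[mp]*blocks≡blocks*nCm m≤n ⟩
      blocks n * (n C m)                        ≈⟨ *-congʳ-mod (n C m) bₙ≈ ⟩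
      (q !) ^ n * (n C m)                       ∎)
      where
      open ≈-mod-Reasoning (p ^ e)
      C′ : ℕ
      C′ = (n * p) C (m * p)
      q!ⁿ≡q!ᵐ*q!ⁿ⁻ᵐ : (q !) ^ n ≡ (q !) ^ m * (q !) ^ (n ∸ m)
      q!ⁿ≡q!ᵐ*q!ⁿ⁻ᵐ = trans (cong ((q !) ^_) (sym (m+[n∸m]≡n m≤n))) (^-distribˡ-+-* (q !) m (n ∸ m))

    blocks≈q!^ : ∀ k → ¬ p ∣ 2 → p ^ 4 ∣ defect * defect →
                 p ^ 4 ∣ defect * blocksCoeff k →
                 blocks k ≈ (q !) ^ k [mod p ^ 4 ]
    blocks≈q!^ k p∤2 p⁴∣defect² p⁴∣defect*coeff =
      square-root-mod p-prime 4 p∤2 (¬∣-^ p-prime p∤q! k) (blocks≈q!^-mod-p k) (begin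
      blocks k * blocks k                                     ≈⟨ blocks-square k p⁴∣defect² ⟩
      (q !) ^ k * (q !) ^ k + defect * blocksCoeff k          ≈⟨ +-congˡ-mod _ (∣⇒≈0 p⁴∣defect*coeff) ⟩
      (q !) ^ k * (q !) ^ k + 0                               ≡⟨ +-identityʳ _ ⟩
      (q !) ^ k * (q !) ^ k                                   ∎)
      where
      open ≈-mod-Reasoning (p ^ 4)

    ∀blocks⇒[np]C[mp]≈nCm : (∀ k → blocks k ≈ (q !) ^ k [mod p ^ 4 ]) →
                             ∀ n m → (n * p) C (m * p) ≈ n C m [mod p ^ 4 ]
    ∀blocks⇒[np]C[mp]≈nCm regular n m with m ≤? n
    ... | yes m≤n = [np]C[mp]≈nCm 4 m≤n (regular m) (regular (n ∸ m)) (regular n)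
    ... | no  m≰n = mod-reflexive (trans (k>n⇒nCk≡0 (*-monoˡ-< p (≰⇒> m≰n))) (sym (k>n⇒nCk≡0 (≰⇒> m≰n))))

    block1≈q!⇒p⁴∣defect : ¬ p ∣ 2 → block 1 ≈ q ! [mod p ^ 4 ] → p ^ 4 ∣ defect
    block1≈q!⇒p⁴∣defect p∤2 block1≈q! = ∣-cancelˡ-^ p-prime 4 p∤2 (≈0⇒∣ (+-cancelʳ-mod (q ! * q !) (begin
      2 * defect + q ! * q !        ≡⟨ +-comm (2 * defect) (q ! * q !) ⟩
      q ! * q ! + 2 * defect        ≈⟨ mod-sym (block-square 1) ⟩
      block 1 * block 1             ≈⟨ *-cong-mod block1≈q! block1≈q! ⟩
      q ! * q !                     ∎)))
      where open ≈-mod-Reasoning (p ^ 4)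

    p∣blocksCoeff : ∀ k → ¬ p ∣ 3 → p ∣ k → p ∣ blocksCoeff k
    p∣blocksCoeff k p∤3 p∣k = ∣-cancelˡ p-prime (¬∣-* p-prime p∤q! p∤q!) (≈0⇒∣ (begin
      q ! * q ! * blocksCoeff k                        ≈⟨ *-linearCoeff (λ _ → q ! * q !) g (λ _ → 1) k G*1≈G ⟩
      ∏ k (λ _ → q ! * q !) * ∑ k (λ t → g t * 1)      ≈⟨ ∣⇒≈0 (∣n⇒∣m*n (∏ k (λ _ → q ! * q !)) p∣∑) ⟩
      0                                                ∎))
      where
      open ≈-mod-Reasoning p
      g : ℕ → ℕ
      g t = pred t * t
      G*1≈G : ∀ {t} → 0 < t → t ≤ k → q ! * q ! * 1 ≈ q ! * q ! [mod p ]
      G*1≈G _ _ = mod-reflexive (*-identityʳ (q ! * q !))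
      p∣3∑ : p ∣ 3 * ∑ k g
      p∣3∑ = ∣m+n∣m⇒∣n (subst (p ∣_) (trans (sym (3*∑pronic+n≡n³ k)) (+-comm _ k)) (∣m⇒∣m*n k (∣m⇒∣m*n k p∣k)))
                         p∣k
      p∣∑ : p ∣ ∑ k (λ t → g t * 1)
      p∣∑ = subst (p ∣_) (∑-cong k (λ {t} _ _ → sym (*-identityʳ (g t)))) (∣-cancelˡ p-prime p∤3 p∣3∑)

    p∣pairCoeff⇒[2Mp]C[Mp]≈[2M]CM : ¬ p ∣ 2 → ¬ p ∣ 3 → p ∣ pairCoeff → ∀ {M} → p ∣ M →
                                    ((M + M) * p) C (M * p) ≈ (M + M) C M [mod p ^ 4 ]
    p∣pairCoeff⇒[2Mp]C[Mp]≈[2M]CM p∤2 p∤3 p∣pairCoeff {M} p∣M =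
      [np]C[mp]≈nCm 4 (m≤m+n M M) (regular p∣M) (regular (subst (p ∣_) (sym (m+n∸m≡n M M)) p∣M))
        (regular (∣m∣n⇒∣m+n p∣M p∣M))
      where
      fourth : ∀ x → x * x * x * x ≡ x * (x * (x * (x * 1)))
      fourth = solve-∀
      p³∣defect : p * p * p ∣ defect
      p³∣defect = *-monoʳ-∣ (p * p) p∣pairCoeff
      p⁴∣defect* : ∀ {x} → p ∣ x → p ^ 4 ∣ defect * x
      p⁴∣defect* {x} p∣x = subst (_∣ defect * x) (fourth p) (*-pres-∣ p³∣defect p∣x)
      regular : ∀ {k} → p ∣ k → blocks k ≈ (q !) ^ k [mod p ^ 4 ]
      regular {k} p∣k = blocks≈q!^ k p∤2 (p⁴∣defect* (∣-trans (n∣m*n (p * p)) p³∣defect))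
                                          (p⁴∣defect* (p∣blocksCoeff k p∤3 p∣k))

    [p+p]Cp≈2⇒wolstenholme : ¬ p ∣ 2 → (p + p) C p ≈ 2 [mod p ^ 4 ] → IsWolstenholme p
    [p+p]Cp≈2⇒wolstenholme p∤2 [p+p]Cp≈2 = unmod (*-cancelˡ-mod p-prime 4 {2} {X} {1} p∤2 (begin
      2 * X        ≡⟨ 2*n≡n+n X ⟩
      X + X        ≡⟨ [p+p]Cp≡[q+p]Cq+[q+p]Cq ⟨
      (p + p) C p  ≈⟨ [p+p]Cp≈2 ⟩
      2 * 1        ∎))
      where
      open ≈-mod-Reasoning (p ^ 4)
      X : ℕ
      X = (q + p) C q

module OddPrime (h : ℕ) where

  q : ℕ
  q = h + h

  open Blocks q

  BinomialCongruence : Set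
  BinomialCongruence = ∀ n m → (n * p) C (m * p) ≡ n C m [mod p ^ 4 ]

  LucasCongruence : Set
  LucasCongruence = ∀ n m n₀ m₀ → n₀ < p → m₀ < p →
                    (n * p ^ 4 + n₀) C (m * p ^ 4 + m₀) ≡ (n C m) * (n₀ C m₀) [mod p ^ 4 ]

  binomial⇒[npᵏ]C[mpᵏ]≈nCm : BinomialCongruence → ∀ k n m → (n * p ^ k) C (m * p ^ k) ≈ n C m [mod p ^ 4 ]
  binomial⇒[npᵏ]C[mpᵏ]≈nCm binomial zero    n m = mod-reflexive (cong₂ _C_ (*-identityʳ n) (*-identityʳ m))
  binomial⇒[npᵏ]C[mpᵏ]≈nCm binomial (suc k) n m = begin
    (n * (p * p ^ k)) C (m * (p * p ^ k))     ≡⟨ cong₂ _C_ (rotate n p (p ^ k)) (rotate m p (p ^ k)) ⟩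
    (n * p ^ k * p) C (m * p ^ k * p)         ≈⟨ mod (binomial (n * p ^ k) (m * p ^ k)) ⟩
    (n * p ^ k) C (m * p ^ k)                 ≈⟨ binomial⇒[npᵏ]C[mpᵏ]≈nCm binomial k n m ⟩
    n C m                                     ∎
    where
    open ≈-mod-Reasoning (p ^ 4)
    rotate : ∀ n p x → n * (p * x) ≡ n * x * p
    rotate = solve-∀

  ∑-reindex-double : ∀ f → ∑ q (λ r → f ((r + r) % p)) ≡ ∑ q f
  ∑-reindex-double f = begin
    ∑ q (λ r → f ((r + r) % p))                                         ≡⟨ ∑-split h h _ ⟩
    ∑ h (λ r → f ((r + r) % p)) + ∑ h (λ s → f ((h + s + (h + s)) % p)) ≡⟨ cong₂ _+_ (∑-cong h (λ {r} _ r≤h → cong f (low r≤h)))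
                                                                                     (∑-cong h (λ {s} 0<s s≤h → cong f (high 0<s s≤h))) ⟩
    ∑ h (λ r → f (r + r)) + ∑ h (λ s → f (s + s ∸ 1))                   ≡⟨ +-comm (∑ h (λ r → f (r + r))) _ ⟩
    ∑ h (λ s → f (s + s ∸ 1)) + ∑ h (λ r → f (r + r))                   ≡⟨ ∑-distrib-+ h (λ s → f (s + s ∸ 1)) (λ r → f (r + r)) ⟨
    ∑ h (λ r → f (r + r ∸ 1) + f (r + r))                               ≡⟨ ∑-pairs h f ⟨
    ∑ q f                                                               ∎
    where
    open ≡-Reasoning
    low : ∀ {r} → r ≤ h → (r + r) % p ≡ r + r
    low r≤h = m<n⇒m%n≡m (s≤s (+-mono-≤ r≤h r≤h))
    shift : ∀ h s → h + suc s + (h + suc s) ≡ s + suc s + suc (h + h)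
    shift = solve-∀
    high : ∀ {s} → 0 < s → s ≤ h → (h + s + (h + s)) % p ≡ s + s ∸ 1
    high {suc s} _ s<h = begin
      (h + suc s + (h + suc s)) % p  ≡⟨ cong (_% p) (shift h s) ⟩
      (s + suc s + p) % p            ≡⟨ [m+n]%n≡m%n (s + suc s) p ⟩
      (s + suc s) % p                ≡⟨ m<n⇒m%n≡m (s≤s (+-mono-≤ (<⇒≤ s<h) s<h)) ⟩
      s + suc s                      ∎

  [r+r]%p≈r+r : ∀ r → (r + r) % p ≈ r + r [mod p ]
  [r+r]%p≈r+r r = mod-sym (subst (_≈ (r + r) % p [mod p ]) (sym (m≡m%n+[m/n]*n (r + r) p))
    (+-multiple-mod ((r + r) % p) ((r + r) / p)))

  module _ (p-prime : Prime p) (5≤p : 5 ≤ p) where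

    p∤2 : ¬ p ∣ 2
    p∤2 = ¬∣-< z<s (≤-trans (m≤m+n 3 2) 5≤p)

    p∤3 : ¬ p ∣ 3
    p∤3 = ¬∣-< z<s (≤-trans (m≤m+n 4 1) 5≤p)

    c : ℕ → ℕ
    c = inverse p-prime

    p∤r : ∀ {r} → 0 < r → r ≤ q → ¬ p ∣ r
    p∤r 0<r r≤q = ¬∣-< 0<r (s≤s r≤q)

    2*c[2r]≈c[r] : ∀ {r} → 0 < r → r ≤ q → 2 * c ((r + r) % p) ≈ c r [mod p ]
    2*c[2r]≈c[r] {r} 0<r r≤q = inverse-unique {x = r} (begin
      r * (2 * c d)    ≡⟨ rearrange r (c d) ⟩
      (r + r) * c d    ≈⟨ *-congʳ-mod (c d) (mod-sym ([r+r]%p≈r+r r)) ⟩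
      d * c d          ≈⟨ *-inverse p-prime p∤d ⟩
      1                ∎) (*-inverse p-prime (p∤r 0<r r≤q))
      where
      open ≈-mod-Reasoning p
      d = (r + r) % p
      rearrange : ∀ r x → r * (2 * x) ≡ (r + r) * x
      rearrange = solve-∀
      p∤d : ¬ p ∣ d
      p∤d = ¬∣-resp-mod ([r+r]%p≈r+r r) (subst (λ x → ¬ p ∣ x) (2*n≡n+n r) (¬∣-* p-prime p∤2 (p∤r 0<r r≤q)))

    pairProduct*c²≈q : ∀ {r} → 0 < r → r ≤ q → pairProduct r * (c r * c r) ≈ q [mod p ]
    pairProduct*c²≈q {r} 0<r r≤q = +-cancelʳ-mod 1 (begin
      pairProduct r * (c r * c r) + 1                 ≈⟨ +-congˡ-mod _ (mod-sym (*-cong-mod rc≈1 rc≈1)) ⟩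
      r * (p ∸ r) * (c r * c r) + r * c r * (r * c r) ≡⟨ factor r (p ∸ r) (c r) ⟩
      r * c r * c r * (p ∸ r + r)                     ≡⟨ cong (r * c r * c r *_) (m∸n+n≡m (m≤n⇒m≤1+n r≤q)) ⟩
      r * c r * c r * p                               ≈⟨ ∣⇒≈0 (n∣m*n (r * c r * c r)) ⟩
      0                                               ≈⟨ mod-sym (∣⇒≈0 (∣-reflexive (+-comm 1 q))) ⟩
      q + 1                                           ∎)
      where
      open ≈-mod-Reasoning p
      rc≈1 : r * c r ≈ 1 [mod p ]
      rc≈1 = *-inverse p-prime (p∤r 0<r r≤q)
      factor : ∀ r s x → r * s * (x * x) + r * x * (r * x) ≡ r * x * x * (s + r)
      factor = solve-∀

    p∣∑c² : p ∣ ∑ q (λ r → c r * c r)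
    p∣∑c² = ∣-cancelˡ p-prime p∤3 (≈0⇒∣ (+-cancelʳ-mod S (begin
      3 * S + S                                         ≡⟨ quadruple S ⟩
      4 * S                                             ≡⟨ cong (4 *_) (∑-reindex-double (λ r → c r * c r)) ⟨
      4 * ∑ q (λ r → c (d r) * c (d r))                 ≡⟨ *-distribˡ-∑ 4 q _ ⟩
      ∑ q (λ r → 4 * (c (d r) * c (d r)))               ≡⟨ ∑-cong q (λ {r} _ _ → square-double (c (d r))) ⟩
      ∑ q (λ r → 2 * c (d r) * (2 * c (d r)))           ≈⟨ ∑-cong-mod q (λ 0<r r≤q → *-cong-mod (2*c[2r]≈c[r] 0<r r≤q) (2*c[2r]≈c[r] 0<r r≤q)) ⟩
      S                                                 ≡⟨ +-identityˡ S ⟨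
      0 + S                                             ∎)))
      where
      open ≈-mod-Reasoning p
      S : ℕ
      S = ∑ q (λ r → c r * c r)
      d : ℕ → ℕ
      d r = (r + r) % p
      quadruple : ∀ x → 3 * x + x ≡ 4 * x
      quadruple = solve-∀
      square-double : ∀ x → 4 * (x * x) ≡ 2 * x * (2 * x)
      square-double = solve-∀

    p∣pairCoeff : p ∣ pairCoeff
    p∣pairCoeff = ∣-cancelˡ p-prime (p∤r 0<q ≤-refl) (≈0⇒∣ (begin
      q * pairCoeff                                   ≈⟨ *-linearCoeff pairProduct (λ _ → 1) (λ r → c r * c r) q pairProduct*c²≈q ⟩
      ∏ q pairProduct * ∑ q (λ r → 1 * (c r * c r))   ≡⟨ cong (∏ q pairProduct *_) (∑-cong q (λ _ _ → *-identityˡ _)) ⟩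
      ∏ q pairProduct * ∑ q (λ r → c r * c r)         ≈⟨ ∣⇒≈0 (∣n⇒∣m*n (∏ q pairProduct) p∣∑c²) ⟩
      0                                               ∎))
      where
      open ≈-mod-Reasoning p
      0<q : 0 < q
      0<q = s≤s⁻¹ (nonTrivial⇒n>1 p {{prime⇒nonTrivial p-prime}})

    wolstenholme⇒binomial : IsWolstenholme p → BinomialCongruence
    wolstenholme⇒binomial wolstenholme n m = unmod (∀blocks⇒[np]C[mp]≈nCm p-prime regular n m)
      where
      p⁴∣defect : p ^ 4 ∣ defect
      p⁴∣defect = block1≈q!⇒p⁴∣defect p-prime p∤2 (wolstenholme⇒block1≈q! wolstenholme)
      regular : ∀ k → blocks k ≈ (q !) ^ k [mod p ^ 4 ]
      regular k = blocks≈q!^ p-prime k p∤2 (∣m⇒∣m*n defect p⁴∣defect) (∣m⇒∣m*n _ p⁴∣defect)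

    binomial⇒wolstenholme : BinomialCongruence → IsWolstenholme p
    binomial⇒wolstenholme binomial = [p+p]Cp≈2⇒wolstenholme p-prime p∤2
      (mod (subst₂ (λ a b → a C b ≡ 2 [mod p ^ 4 ]) (2*n≡n+n p) (*-identityˡ p) (binomial 2 1)))

    binomial⇒lucas : BinomialCongruence → LucasCongruence
    binomial⇒lucas binomial n m n₀ m₀ n₀<p m₀<p = unmod (begin
      (n * p ^ 4 + n₀) C (m * p ^ 4 + m₀)             ≡⟨ cong (λ k → (n * p ^ 4 + n₀) C (k + m₀)) (rotate m p) ⟩
      (n * p ^ 4 + n₀) C (m * p ^ 3 * p + m₀)         ≈⟨ lucas p-prime 4 (n∣m*n n) n₀ (m * p ^ 3) m₀ n₀<p m₀<p ⟩
      ((n * p ^ 4) C (m * p ^ 3 * p)) * (n₀ C m₀)     ≡⟨ cong (λ k → ((n * p ^ 4) C k) * (n₀ C m₀)) (rotate m p) ⟨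
      ((n * p ^ 4) C (m * p ^ 4)) * (n₀ C m₀)         ≈⟨ *-congʳ-mod (n₀ C m₀) (binomial⇒[npᵏ]C[mpᵏ]≈nCm binomial 4 n m) ⟩
      (n C m) * (n₀ C m₀)                             ∎)
      where
      open ≈-mod-Reasoning (p ^ 4)
      rotate : ∀ m p → m * (p * (p * (p * (p * 1)))) ≡ m * (p * (p * (p * 1))) * p
      rotate = solve-∀

    [2pM]C[pM]≈[2M]CM : ∀ {M} → p ∣ M → (p * M + p * M) C (p * M) ≈ (M + M) C M [mod p ^ 4 ]
    [2pM]C[pM]≈[2M]CM {M} p∣M = subst₂ (λ a b → a C b ≈ (M + M) C M [mod p ^ 4 ])
      (trans (*-comm (M + M) p) (*-distribˡ-+ p M M)) (*-comm M p)
      (p∣pairCoeff⇒[2Mp]C[Mp]≈[2M]CM p-prime p∤2 p∤3 p∣pairCoeff p∣M)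

    lucas⇒wolstenholme : LucasCongruence → IsWolstenholme p
    lucas⇒wolstenholme lucasCongruence = [p+p]Cp≈2⇒wolstenholme p-prime p∤2 (begin
      (p + p) C p                         ≡⟨ cong (λ k → (k + k) C k) (*-identityʳ p) ⟨
      (p ^ 1 + p ^ 1) C (p ^ 1)           ≈⟨ mod-sym ([2pM]C[pM]≈[2M]CM {p ^ 1} (m∣m*n 1)) ⟩
      (p ^ 2 + p ^ 2) C (p ^ 2)           ≈⟨ mod-sym ([2pM]C[pM]≈[2M]CM {p ^ 2} (m∣m*n (p ^ 1))) ⟩
      (p ^ 3 + p ^ 3) C (p ^ 3)           ≈⟨ mod-sym ([2pM]C[pM]≈[2M]CM {p ^ 3} (m∣m*n (p ^ 2))) ⟩
      (p ^ 4 + p ^ 4) C (p ^ 4)           ≡⟨ cong₂ _C_ (2*n≡n+n (p ^ 4)) (*-identityˡ (p ^ 4)) ⟨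
      (2 * p ^ 4) C (1 * p ^ 4)           ≡⟨ cong₂ _C_ (+-identityʳ (2 * p ^ 4)) (+-identityʳ (1 * p ^ 4)) ⟨
      (2 * p ^ 4 + 0) C (1 * p ^ 4 + 0)   ≈⟨ mod (lucasCongruence 2 1 0 0 (s≤s z≤n) (s≤s z≤n)) ⟩
      2                                   ∎)
      where open ≈-mod-Reasoning (p ^ 4)

    equivalences : (IsWolstenholme p ⇔ BinomialCongruence) × (BinomialCongruence ⇔ LucasCongruence)
    equivalences = mk⇔ wolstenholme⇒binomial binomial⇒wolstenholme
                 , mk⇔ binomial⇒lucas (wolstenholme⇒binomial ∘ lucas⇒wolstenholme)

even-or-odd : ∀ n → ∃[ h ] (n ≡ h + h ⊎ n ≡ suc (h + h))
even-or-odd zero    = 0 , inj₁ refl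
even-or-odd (suc n) with even-or-odd n
... | h , inj₁ refl = h , inj₂ refl
... | h , inj₂ refl = suc h , inj₁ (cong suc (sym (+-suc h h)))

odd-prime : ∀ {p} → Prime p → 3 ≤ p → ∃[ h ] p ≡ suc (h + h)
odd-prime {p} p-prime 3≤p with even-or-odd p
... | h , inj₂ p≡1+2h = h , p≡1+2h
... | h , inj₁ refl with prime⇒irreducible p-prime (divides h (trans (sym (2*n≡n+n h)) (*-comm 2 h)))
...   | inj₁ ()
...   | inj₂ 2≡p = ⊥-elim (<⇒≱ 3≤p (≤-reflexive (sym 2≡p)))

mainTheorem3 : (p : ℕ) → Prime p → 5 ≤ p →
    (IsWolstenholme p ⇔ (∀ n m → (n * p) C (m * p) ≡ n C m [mod p ^ 4 ]))
    × ((∀ n m → (n * p) C (m * p) ≡ n C m [mod p ^ 4 ])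
       ⇔ (∀ n m n₀ m₀ → n₀ < p → m₀ < p →
            (n * p ^ 4 + n₀) C (m * p ^ 4 + m₀) ≡ (n C m) * (n₀ C m₀) [mod p ^ 4 ]))
mainTheorem3 p p-prime 5≤p with odd-prime p-prime (≤-trans (m≤m+n 3 2) 5≤p)
... | h , refl = OddPrime.equivalences h p-prime 5≤p
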